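{- Let $S$ be a set of variables of $R_m$. Then $S$ is a facet of $\mathcal{T}_m$ if and only if one of the following holds: (i) $z_1\in S$, $z_2\notin S$, and there is $j\in[m]$ with $S\cap V(e_j)=\{\overrightarrow{y}_j,z_{e_j}\}$ while for each $k\ne j$, $S\cap V(e_k)$ is a single variable, lying in $\{t_k,z_{e_k}\}$ if $k<j$ and in $\{t_k,\overrightarrow{y}_k\}$ if $k>j$; (ii) $z_2\in S$, $z_1\notin S$, and there is $j\in[m]$ with $S\cap V(e_j)=\{\overleftarrow{y}_j,z_{e_j}\}$ while for each $k\ne j$, $S\cap V(e_k)$ is a single variable, lying in $\{t_k,\overleftarrow{y}_k\}$ if $k<j$ and in $\{t_k,z_{e_k}\}$ if $k>j$; (iii) $z_1,z_2\in S$ and for every $k\in[m]$, $S\cap V(e_k)$ is a single variable lying in $\{z_{e_k},t_k\}$.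
   Context: Let $m\ge1$ and let $I_m$ be the graph on $\{1,2\}$ with exactly $m$ parallel edges $e_1,\ldots,e_m$ between $1$ and $2$. Its cosmological polytope $\mathcal{C}_{I_m}\subset\mathbb{R}^{\{1,2\}\cup\{e_1,\ldots,e_m\}}$ is the convex hull of $\mathbf{e}_1+\mathbf{e}_2-\mathbf{e}_{e_i}$, $\mathbf{e}_1-\mathbf{e}_2+\mathbf{e}_{e_i}$, $-\mathbf{e}_1+\mathbf{e}_2+\mathbf{e}_{e_i}$ ($i\in[m]$), of dimension $m+1$. Let $R_m$ be the polynomial ring over a field in the variables $z_1,z_2$ (for $\mathbf{e}_1,\mathbf{e}_2$), and for each $i$: $z_{e_i}$ (for $\mathbf{e}_{e_i}$), $t_i$ (for $\mathbf{e}_1+\mathbf{e}_2-\mathbf{e}_{e_i}$), $\overrightarrow{y}_i$ (for $\mathbf{e}_1-\mathbf{e}_2+\mathbf{e}_{e_i}$), $\overleftarrow{y}_i$ (for $-\mathbf{e}_1+\mathbf{e}_2+\mathbf{e}_{e_i}$); $V(e_i)=\{\overrightarrow{y}_i,\overleftarrow{y}_i,t_i,z_{e_i}\}$. Let $<$ be the lexicographic term order induced by $\overrightarrow{y}_1>\cdots>\overrightarrow{y}_m>\overleftarrow{y}_m>\cdots>\overleftarrow{y}_1>z_{e_1}>\cdots>z_{e_m}>t_1>\cdots>t_m>z_1>z_2$. Let $B$ be the set of binomials consisting of, for each $i$: $\overrightarrow{y}_i\overleftarrow{y}_i-z_{e_i}^2$, $\overrightarrow{y}_it_i-z_1^2$,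 $\overleftarrow{y}_it_i-z_2^2$, $\overrightarrow{y}_iz_2-z_1z_{e_i}$, $\overleftarrow{y}_iz_1-z_2z_{e_i}$, $t_iz_{e_i}-z_1z_2$; and, for each $i\ne k$: $\overrightarrow{y}_i\overleftarrow{y}_k-z_{e_i}z_{e_k}$, $\overrightarrow{y}_iz_{e_k}-\overrightarrow{y}_kz_{e_i}$, $\overleftarrow{y}_iz_{e_k}-\overleftarrow{y}_kz_{e_i}$. A facet of $\mathcal{T}_m$ is a set $S$ of $m+2$ variables that does not contain all variables of the $<$-leading monomial of any binomial in $B$ (the corresponding simplices form a unimodular triangulation $\mathcal{T}_m$ of $\mathcal{C}_{I_m}$). -}

module Defs where

open import Data.Nat using (ℕ; _+_; _*_; _∸_; _<_; _≟_)
open import Data.Fin using (Fin; toℕ)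
open import Data.List using (List; []; _∷_; _++_; length; filter; map; concatMap; allFin)
open import Data.Nat.ListAction using (sum)
open import Data.List.Relation.Unary.All using (All)
open import Data.Bool using (Bool; true; false; if_then_else_)
open import Data.Product using (Σ; _×_; _,_)
open import Data.Sum using (_⊎_)
open import Relation.Binary.PropositionalEquality using (_≡_; _≢_)
open import Relation.Nullary using (¬_)

-- Variables of R_m (edges e_1..e_m indexed by Fin m, 0-based, order preserved):
--   z1, z2, ze i = z_{e_i}, t i = t_i, yr i = y→_i, yl i = y←_i
data Var (m : ℕ) : Set where
  z1 z2 : Var m
  ze t yr yl : Fin m → Var m

allVars : (m : ℕ) → List (Var m)
allVars m = z1 ∷ z2 ∷ concatMap (λ i → ze i ∷ t i ∷ yr i ∷ yl i ∷ []) (allFin m)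

VarSet : ℕ → Set
VarSet m = Var m → Bool

card : {m : ℕ} → VarSet m → ℕ
card {m} S = sum (map (λ v → if S v then 1 else 0) (allVars m))

-- Rank realising the variable order (larger rank = larger variable):
-- y→1 > ... > y→m > y←m > ... > y←1 > z_{e1} > ... > z_{em} > t1 > ... > tm > z1 > z2
rank : {m : ℕ} → Var m → ℕ
rank z2 = 0
rank z1 = 1
rank {m} (t i)  = (1 + m) ∸ toℕ i
rank {m} (ze i) = (1 + 2 * m) ∸ toℕ i
rank {m} (yl i) = (2 + 2 * m) + toℕ i
rank {m} (yr i) = (1 + 4 * m) ∸ toℕ i

Mono : ℕ → Set
Mono m = List (Var m)

expo : {m : ℕ} → Mono m → Var m → ℕ
expo μ v = length (filter (λ x → rank x ≟ rank v) μ)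

_<lex_ : {m : ℕ} → Mono m → Mono m → Set
_<lex_ {m} ν μ = Σ (Var m) λ v → expo ν v < expo μ v × (∀ w → rank v < rank w → expo ν w ≡ expo μ w)

-- A binomial μ - ν, recorded as the pair of its two monomials.
Binom : ℕ → Set
Binom m = Mono m × Mono m

data InB {m : ℕ} : Binom m → Set where
  b1 : ∀ i → InB (yr i ∷ yl i ∷ [] , ze i ∷ ze i ∷ [])
  b2 : ∀ i → InB (yr i ∷ t i ∷ [] , z1 ∷ z1 ∷ [])
  b3 : ∀ i → InB (yl i ∷ t i ∷ [] , z2 ∷ z2 ∷ [])
  b4 : ∀ i → InB (yr i ∷ z2 ∷ [] , z1 ∷ ze i ∷ [])
  b5 : ∀ i → InB (yl i ∷ z1 ∷ [] , z2 ∷ ze i ∷ [])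
  b6 : ∀ i → InB (t i ∷ ze i ∷ [] , z1 ∷ z2 ∷ [])
  b7 : ∀ i k → i ≢ k → InB (yr i ∷ yl k ∷ [] , ze i ∷ ze k ∷ [])
  b8 : ∀ i k → i ≢ k → InB (yr i ∷ ze k ∷ [] , yr k ∷ ze i ∷ [])
  b9 : ∀ i k → i ≢ k → InB (yl i ∷ ze k ∷ [] , yl k ∷ ze i ∷ [])

data LeadingMonomial {m : ℕ} : Binom m → Mono m → Set where
  lead₁ : ∀ {μ ν} → ν <lex μ → LeadingMonomial (μ , ν) μ
  lead₂ : ∀ {μ ν} → ν <lex μ → LeadingMonomial (ν , μ) μ

IsFacet : (m : ℕ) → VarSet m → Set
IsFacet m S = card S ≡ m + 2
  × (∀ b μ → InB b → LeadingMonomial b μ → ¬ All (λ v → S v ≡ true) μ)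

-- S ∩ V(e_k), as membership bits of (y→_k, y←_k, t_k, z_{e_k})
inter : {m : ℕ} → VarSet m → Fin m → Bool × Bool × Bool × Bool
inter S k = S (yr k) , S (yl k) , S (t k) , S (ze k)

{-# OPTIONS --safe #-}
-- Since the order ranks the variables by kind (z2 < z1 < t < z_e < y← < y→), the
-- leading monomials of B are y→_i y←_k, y→_i t_i, y←_i t_i, y→_i z2, y←_i z1,
-- t_i z_{e_i}, and y→_i z_{e_k} for i < k, y←_i z_{e_k} for k < i. A set avoiding
-- them meets each V(e_k) in ∅, a singleton, {y→_k, z_{e_k}} or {y←_k, z_{e_k}}, and
-- in at most one two-element block. As the m blocks and S ∩ {z1, z2} hold m + 2
-- variables, either z1, z2 ∈ S and every block is a singleton, or exactly one of
-- z1, z2 lies in S and exactly one block j has two elements; the remaining leading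
-- monomials (y← with z1, y→ with z2, y→_i z_{e_k}, y←_i z_{e_k}) then dictate the
-- blocks before and after j.
module Submission where

open import Defs
open import Data.Nat using (ℕ; _≤_)
open import Data.Fin using (Fin) renaming (_<_ to _<ᶠ_)
open import Data.Bool using (Bool; true; false)
open import Data.Product using (Σ; _×_; _,_)
open import Data.Sum using (_⊎_)
open import Relation.Binary.PropositionalEquality using (_≡_; _≢_)
open import Function.Bundles using (_⇔_)

open import Data.Bool using (if_then_else_)
open import Data.Bool.Properties using (not-¬)
open import Data.Empty using (⊥-elim)
open import Data.Fin using (zero; suc; toℕ)
import Data.Fin.Properties as Fin
open import Data.List using (List; []; _∷_; length; filter; map; tabulate; concatMap; allFin)
open import Data.List.Membership.Propositional using (_∈_)
open import Data.List.Properties using (filter-some; filter-none; map-concatMap; map-tabulate; tabulate-cong)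
open import Data.List.Relation.Unary.All as All using (All; []; _∷_)
open import Data.List.Relation.Unary.Any as Any using (here; there)
open import Data.Nat using (zero; suc; _+_; _*_; _∸_; _<_; _≟_; _<?_; z≤n; s≤s)
open import Data.Nat.ListAction using (sum)
open import Data.Nat.ListAction.Properties using (sum-++)
open import Data.Nat.Properties
open import Data.Product using (∃; proj₁; proj₂)
open import Data.Sum using (inj₁; inj₂; [_,_]′; swap)
open import Function using (_∘_; id)
open import Function.Bundles using (mk⇔)
open import Relation.Binary.Definitions using (tri<; tri≈; tri>)
open import Relation.Binary.PropositionalEquality
  using (refl; sym; trans; cong; subst; subst₂; module ≡-Reasoning)
open import Relation.Nullary using (¬_; yes; no; contradiction)
open import Relation.Nullary.Decidable using (True; toWitness)

tier : ∀ {m} → Var m → ℕ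
tier z2     = 0
tier z1     = 1
tier (t _)  = 2
tier (ze _) = 3
tier (yl _) = 4
tier (yr _) = 5

band : ℕ → ℕ → ℕ
band m 0             = 0
band m 1             = 1
band m (suc (suc n)) = 2 + n * m

band-mono : ∀ {m a c} → a ≤ c → band m a ≤ band m c
band-mono {a = 0}                         _                 = z≤n
band-mono {a = 1} {1}                     _                 = ≤-refl
band-mono {a = 1} {suc (suc c)}           _                 = s≤s z≤n
band-mono {m} {suc (suc a)} {suc (suc c)} (s≤s (s≤s a≤c)) = s≤s (s≤s (*-monoˡ-≤ m a≤c))

n+i<m+n : ∀ n {i m} → i < m → n + i < m + n
n+i<m+n n {i} {m} i<m = subst (_< m + n) (+-comm i n) (+-monoˡ-< n i<m)

rank-lower : ∀ {m} (v : Var m) → band m (tier v) ≤ rank v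
rank-lower z2         = z≤n
rank-lower z1         = ≤-refl
rank-lower (t i)      = m+n≤o⇒m≤o∸n 2 (s≤s (Fin.toℕ<n i))
rank-lower {m} (ze i) = m+n≤o⇒m≤o∸n (2 + 1 * m) (s≤s (n+i<m+n (m + 0) (Fin.toℕ<n i)))
rank-lower (yl i)     = m≤m+n _ _
rank-lower {m} (yr i) = m+n≤o⇒m≤o∸n (2 + 3 * m) (s≤s (n+i<m+n (3 * m) (Fin.toℕ<n i)))

rank-upper : ∀ {m} (v : Var m) → rank v < band m (suc (tier v))
rank-upper z2         = s≤s z≤n
rank-upper z1         = ≤-refl
rank-upper {m} (t i)  =
  s≤s (subst (suc m ∸ toℕ i ≤_) (sym (cong suc (+-identityʳ m))) (m∸n≤m (suc m) (toℕ i)))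
rank-upper {m} (ze i) = s≤s (m∸n≤m (suc (2 * m)) (toℕ i))
rank-upper {m} (yl i) = s≤s (s≤s (n+i<m+n (2 * m) (Fin.toℕ<n i)))
rank-upper {m} (yr i) = s≤s (m∸n≤m (suc (4 * m)) (toℕ i))

rank-< : ∀ {m} (v w : Var m) → {True (tier v <? tier w)} → rank v < rank w
rank-< v w {tv<tw} = <-≤-trans (rank-upper v) (≤-trans (band-mono (toWitness tv<tw)) (rank-lower w))

rank-yr-anti : ∀ {m} {i k : Fin m} → i <ᶠ k → rank (yr k) < rank (yr i)
rank-yr-anti {m} {k = k} i<k =
  ∸-monoʳ-< i<k (m≤n⇒m≤1+n (<⇒≤ (<-≤-trans (Fin.toℕ<n k) (m≤m+n m (3 * m)))))

rank-yl-mono : ∀ {m} {i k : Fin m} → i <ᶠ k → rank (yl i) < rank (yl k)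
rank-yl-mono {m} i<k = +-monoʳ-< (2 + 2 * m) i<k

-- The lexicographic order

expo-∈ : ∀ {m} {v : Var m} {μ} → v ∈ μ → 0 < expo μ v
expo-∈ {v = v} v∈μ =
  filter-some (λ x → rank x ≟ rank v) (Any.map (λ v≡x → cong rank (sym v≡x)) v∈μ)

expo-below : ∀ {m} {v : Var m} {μ} → All (λ x → rank x < rank v) μ → expo μ v ≡ 0
expo-below {v = v} μ<v = cong length (filter-none (λ x → rank x ≟ rank v) (All.map <⇒≢ μ<v))

expo-cong : ∀ {m} (μ : Mono m) {v w} → rank v ≡ rank w → expo μ v ≡ expo μ w
expo-cong μ eq = cong (λ r → length (filter (λ x → rank x ≟ r) μ)) eq

<lex-by-top : ∀ {m} {v : Var m} μ ν → v ∈ μ →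
              All (λ x → rank x ≤ rank v) μ → All (λ x → rank x < rank v) ν → ν <lex μ
<lex-by-top {v = v} μ ν v∈μ μ≤v ν<v = v , at-v , above-v
  where
  at-v : expo ν v < expo μ v
  at-v = subst (_< expo μ v) (sym (expo-below {v = v} ν<v)) (expo-∈ v∈μ)
  above-v : ∀ w → rank v < rank w → expo ν w ≡ expo μ w
  above-v w v<w = trans (expo-below {v = w} (All.map (λ x<v → <-trans x<v v<w) ν<v))
                        (sym (expo-below {v = w} (All.map (λ x≤v → ≤-<-trans x≤v v<w) μ≤v)))

<lex-pair : ∀ {m} (a b c d : Var m) → rank b ≤ rank a → rank c < rank a → rank d < rank a →
            (c ∷ d ∷ []) <lex (a ∷ b ∷ [])
<lex-pair a b c d b≤a c<a d<a =
  <lex-by-top (a ∷ b ∷ []) (c ∷ d ∷ []) (here refl) (≤-refl ∷ b≤a ∷ []) (c<a ∷ d<a ∷ [])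

<lex-asym : ∀ {m} {μ ν : Mono m} → ν <lex μ → ¬ μ <lex ν
<lex-asym {μ = μ} {ν} (v , ν<μ , above-v) (w , μ<ν , above-w) with <-cmp (rank v) (rank w)
... | tri< v<w _ _ = <-irrefl (sym (above-v w v<w)) μ<ν
... | tri≈ _ v≡w _ =
  <-asym ν<μ (subst₂ _<_ (expo-cong μ {w} {v} (sym v≡w)) (expo-cong ν {w} {v} (sym v≡w)) μ<ν)
... | tri> _ _ w<v = <-irrefl (sym (above-w v w<v)) ν<μ

leading-unique : ∀ {m} {b : Binom m} {μ ρ} → LeadingMonomial b μ → LeadingMonomial b ρ → μ ≡ ρ
leading-unique (lead₁ _)           (lead₁ _)   = refl
leading-unique (lead₁ {μ} {ν} ν<μ) (lead₂ μ<ν) = contradiction μ<ν (<lex-asym {μ = μ} {ν} ν<μ)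
leading-unique (lead₂ _)           (lead₂ _)   = refl
leading-unique (lead₂ {μ} {ν} ν<μ) (lead₁ μ<ν) = contradiction μ<ν (<lex-asym {μ = μ} {ν} ν<μ)

-- Leading monomials of B

data LeadingOfB {m : ℕ} : Mono m → Set where
  yr·yl : ∀ i k → LeadingOfB (yr i ∷ yl k ∷ [])
  yr·t  : ∀ i → LeadingOfB (yr i ∷ t i ∷ [])
  yl·t  : ∀ i → LeadingOfB (yl i ∷ t i ∷ [])
  yr·z2 : ∀ i → LeadingOfB (yr i ∷ z2 ∷ [])
  yl·z1 : ∀ i → LeadingOfB (yl i ∷ z1 ∷ [])
  t·ze  : ∀ i → LeadingOfB (t i ∷ ze i ∷ [])
  yr·ze : ∀ i k → i <ᶠ k → LeadingOfB (yr i ∷ ze k ∷ [])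
  yl·ze : ∀ i k → k <ᶠ i → LeadingOfB (yl i ∷ ze k ∷ [])

module _ {m : ℕ} where
  lex-yr·yl : ∀ (i k : Fin m) → (ze i ∷ ze k ∷ []) <lex (yr i ∷ yl k ∷ [])
  lex-yr·yl i k = <lex-pair (yr i) (yl k) (ze i) (ze k)
    (<⇒≤ (rank-< (yl k) (yr i))) (rank-< (ze i) (yr i)) (rank-< (ze k) (yr i))

  lex-yr·t : ∀ (i : Fin m) → (z1 ∷ z1 ∷ []) <lex (yr i ∷ t i ∷ [])
  lex-yr·t i = <lex-pair (yr i) (t i) z1 z1
    (<⇒≤ (rank-< (t i) (yr i))) (rank-< z1 (yr i)) (rank-< z1 (yr i))

  lex-yl·t : ∀ (i : Fin m) → (z2 ∷ z2 ∷ []) <lex (yl i ∷ t i ∷ [])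
  lex-yl·t i = <lex-pair (yl i) (t i) z2 z2
    (<⇒≤ (rank-< (t i) (yl i))) (rank-< z2 (yl i)) (rank-< z2 (yl i))

  lex-yr·z2 : ∀ (i : Fin m) → (z1 ∷ ze i ∷ []) <lex (yr i ∷ z2 ∷ [])
  lex-yr·z2 i = <lex-pair (yr i) z2 z1 (ze i)
    (<⇒≤ (rank-< z2 (yr i))) (rank-< z1 (yr i)) (rank-< (ze i) (yr i))

  lex-yl·z1 : ∀ (i : Fin m) → (z2 ∷ ze i ∷ []) <lex (yl i ∷ z1 ∷ [])
  lex-yl·z1 i = <lex-pair (yl i) z1 z2 (ze i)
    (<⇒≤ (rank-< z1 (yl i))) (rank-< z2 (yl i)) (rank-< (ze i) (yl i))

  lex-t·ze : ∀ (i : Fin m) → (z1 ∷ z2 ∷ []) <lex (t i ∷ ze i ∷ [])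
  lex-t·ze i = <lex-by-top (t i ∷ ze i ∷ []) (z1 ∷ z2 ∷ []) (there (here refl))
    (<⇒≤ (rank-< (t i) (ze i)) ∷ ≤-refl ∷ []) (rank-< z1 (ze i) ∷ rank-< z2 (ze i) ∷ [])

  lex-yr·ze : ∀ (i k : Fin m) → i <ᶠ k → (yr k ∷ ze i ∷ []) <lex (yr i ∷ ze k ∷ [])
  lex-yr·ze i k i<k = <lex-pair (yr i) (ze k) (yr k) (ze i)
    (<⇒≤ (rank-< (ze k) (yr i))) (rank-yr-anti i<k) (rank-< (ze i) (yr i))

  lex-yl·ze : ∀ (i k : Fin m) → k <ᶠ i → (yl k ∷ ze i ∷ []) <lex (yl i ∷ ze k ∷ [])
  lex-yl·ze i k k<i = <lex-pair (yl i) (ze k) (yl k) (ze i)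
    (<⇒≤ (rank-< (ze k) (yl i))) (rank-yl-mono k<i) (rank-< (ze i) (yl i))

leading-of-B : ∀ {m} {b : Binom m} {μ} → InB b → LeadingMonomial b μ → LeadingOfB μ
leading-of-B (b1 i)       L = subst LeadingOfB (leading-unique (lead₁ (lex-yr·yl i i)) L) (yr·yl i i)
leading-of-B (b2 i)       L = subst LeadingOfB (leading-unique (lead₁ (lex-yr·t i)) L) (yr·t i)
leading-of-B (b3 i)       L = subst LeadingOfB (leading-unique (lead₁ (lex-yl·t i)) L) (yl·t i)
leading-of-B (b4 i)       L = subst LeadingOfB (leading-unique (lead₁ (lex-yr·z2 i)) L) (yr·z2 i)
leading-of-B (b5 i)       L = subst LeadingOfB (leading-unique (lead₁ (lex-yl·z1 i)) L) (yl·z1 i)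
leading-of-B (b6 i)       L = subst LeadingOfB (leading-unique (lead₁ (lex-t·ze i)) L) (t·ze i)
leading-of-B (b7 i k _)   L = subst LeadingOfB (leading-unique (lead₁ (lex-yr·yl i k)) L) (yr·yl i k)
leading-of-B (b8 i k i≢k) L with Fin.<-cmp i k
... | tri< i<k _ _ = subst LeadingOfB (leading-unique (lead₁ (lex-yr·ze i k i<k)) L) (yr·ze i k i<k)
... | tri≈ _ i≡k _ = contradiction i≡k i≢k
... | tri> _ _ k<i = subst LeadingOfB (leading-unique (lead₂ (lex-yr·ze k i k<i)) L) (yr·ze k i k<i)
leading-of-B (b9 i k i≢k) L with Fin.<-cmp i k
... | tri< i<k _ _ = subst LeadingOfB (leading-unique (lead₂ (lex-yl·ze k i i<k)) L) (yl·ze k i i<k)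
... | tri≈ _ i≡k _ = contradiction i≡k i≢k
... | tri> _ _ k<i = subst LeadingOfB (leading-unique (lead₁ (lex-yl·ze i k k<i)) L) (yl·ze i k k<i)

leading-in-B : ∀ {m} {μ : Mono m} → LeadingOfB μ → ∃ λ b → InB b × LeadingMonomial b μ
leading-in-B (yr·yl i k) with i Fin.≟ k
... | yes refl = _ , b1 i , lead₁ (lex-yr·yl i i)
... | no i≢k   = _ , b7 i k i≢k , lead₁ (lex-yr·yl i k)
leading-in-B (yr·t i)        = _ , b2 i , lead₁ (lex-yr·t i)
leading-in-B (yl·t i)        = _ , b3 i , lead₁ (lex-yl·t i)
leading-in-B (yr·z2 i)       = _ , b4 i , lead₁ (lex-yr·z2 i)
leading-in-B (yl·z1 i)       = _ , b5 i , lead₁ (lex-yl·z1 i)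
leading-in-B (t·ze i)        = _ , b6 i , lead₁ (lex-t·ze i)
leading-in-B (yr·ze i k i<k) = _ , b8 i k (Fin.<⇒≢ i<k) , lead₁ (lex-yr·ze i k i<k)
leading-in-B (yl·ze i k k<i) = _ , b9 i k (Fin.<⇒≢ k<i ∘ sym) , lead₁ (lex-yl·ze i k k<i)

AvoidsLeading : ∀ {m} → VarSet m → Set
AvoidsLeading {m} S = ∀ {μ : Mono m} → LeadingOfB μ → ¬ All (λ v → S v ≡ true) μ

module _ {m : ℕ} {S : VarSet m} where
  no-leading⇒avoids : (∀ b μ → InB b → LeadingMonomial b μ → ¬ All (λ v → S v ≡ true) μ) →
                      AvoidsLeading S
  no-leading⇒avoids no-leading L with leading-in-B L
  ... | b , b∈B , lead = no-leading b _ b∈B lead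

  avoids⇒no-leading : AvoidsLeading S →
                      ∀ b μ → InB b → LeadingMonomial b μ → ¬ All (λ v → S v ≡ true) μ
  avoids⇒no-leading avoids _ _ b∈B lead = avoids (leading-of-B b∈B lead)

bit : Bool → ℕ
bit b = if b then 1 else 0

-- The summands follow the order in which allVars lists V(e_k), so that card unfolds to counts.
count : Bool × Bool × Bool × Bool → ℕ
count (r , l , s , z) = bit z + (bit s + (bit r + (bit l + 0)))

blockCount : ∀ {m} → VarSet m → Fin m → ℕ
blockCount S k = count (inter S k)

∑ : ∀ {n} → (Fin n → ℕ) → ℕ
∑ g = sum (tabulate g)

sum-concatMap : ∀ {A : Set} (g : A → List ℕ) xs → sum (concatMap g xs) ≡ sum (map (sum ∘ g) xs)
sum-concatMap g []       = refl
sum-concatMap g (x ∷ xs) =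
  trans (sum-++ (g x) (concatMap g xs)) (cong (sum (g x) +_) (sum-concatMap g xs))

card-blocks : ∀ {m} (S : VarSet m) → card S ≡ bit (S z1) + (bit (S z2) + ∑ (blockCount S))
card-blocks {m} S = cong (λ n → bit (S z1) + (bit (S z2) + n)) (begin
  sum (map ind (concatMap V (allFin m)))    ≡⟨ cong sum (map-concatMap ind V (allFin m)) ⟩
  sum (concatMap (map ind ∘ V) (allFin m))  ≡⟨ sum-concatMap (map ind ∘ V) (allFin m) ⟩
  sum (map (sum ∘ map ind ∘ V) (allFin m))  ≡⟨ cong sum (map-tabulate id (sum ∘ map ind ∘ V)) ⟩
  ∑ (blockCount S)                          ∎)
  where
  open ≡-Reasoning
  ind : Var m → ℕ
  ind v = bit (S v)
  V : Fin m → List (Var m)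
  V k = ze k ∷ t k ∷ yr k ∷ yl k ∷ []

card≡m+2 : ∀ {m} (S : VarSet m) {a b} → S z1 ≡ a → S z2 ≡ b →
           bit a + (bit b + ∑ (blockCount S)) ≡ 2 + m → card S ≡ m + 2
card≡m+2 {m} S refl refl eq = trans (card-blocks S) (trans eq (+-comm 2 m))

+-tight : ∀ {a b c d} → a ≤ c → b ≤ d → a + b ≡ c + d → a ≡ c × b ≡ d
+-tight {a} {b} {c} {d} a≤c b≤d eq = a≡c , +-cancelˡ-≡ a b d (trans eq (cong (_+ d) (sym a≡c)))
  where
  a≡c : a ≡ c
  a≡c = ≤-antisym a≤c (+-cancelʳ-≤ d c a (subst (_≤ a + d) eq (+-monoʳ-≤ a b≤d)))

∑-mono-≤ : ∀ {n} {g h : Fin n → ℕ} → (∀ k → g k ≤ h k) → ∑ g ≤ ∑ h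
∑-mono-≤ {zero}  _   = z≤n
∑-mono-≤ {suc n} g≤h = +-mono-≤ (g≤h zero) (∑-mono-≤ (g≤h ∘ suc))

∑-mono-tight : ∀ {n} {g h : Fin n → ℕ} → (∀ k → g k ≤ h k) → ∑ g ≡ ∑ h →
               ∀ k → g k ≡ h k
∑-mono-tight {suc n} {g} {h} g≤h ∑≡ = λ where
    zero    → proj₁ head-tail
    (suc k) → ∑-mono-tight (g≤h ∘ suc) (proj₂ head-tail) k
  where
  head-tail : g zero ≡ h zero × ∑ (g ∘ suc) ≡ ∑ (h ∘ suc)
  head-tail = +-tight (g≤h zero) (∑-mono-≤ (g≤h ∘ suc)) ∑≡

∑-cong : ∀ {n} {g h : Fin n → ℕ} → (∀ k → g k ≡ h k) → ∑ g ≡ ∑ h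
∑-cong g≗h = cong sum (tabulate-cong g≗h)

∑-ones : ∀ n → ∑ {n} (λ _ → 1) ≡ n
∑-ones zero    = refl
∑-ones (suc n) = cong suc (∑-ones n)

twoAt : ∀ {n} → Fin n → Fin n → ℕ
twoAt zero    zero    = 2
twoAt zero    (suc _) = 1
twoAt (suc _) zero    = 1
twoAt (suc j) (suc k) = twoAt j k

∑-twoAt : ∀ {n} (j : Fin n) → ∑ (twoAt j) ≡ suc n
∑-twoAt {suc n} zero    = cong (2 +_) (∑-ones n)
∑-twoAt         (suc j) = cong suc (∑-twoAt j)

twoAt-self : ∀ {n} (j : Fin n) → twoAt j j ≡ 2
twoAt-self zero    = refl
twoAt-self (suc j) = twoAt-self j

twoAt-other : ∀ {n} {j k : Fin n} → k ≢ j → twoAt j k ≡ 1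
twoAt-other {j = zero}  {zero}  0≢0 = contradiction refl 0≢0
twoAt-other {j = zero}  {suc k} _   = refl
twoAt-other {j = suc j} {zero}  _   = refl
twoAt-other {j = suc j} {suc k} k≢j = twoAt-other (k≢j ∘ cong suc)

∑≤n : ∀ {n} {g : Fin n → ℕ} → (∀ k → g k ≤ 1) → ∑ g ≤ n
∑≤n {n} {g} g≤1 = subst (∑ g ≤_) (∑-ones n) (∑-mono-≤ g≤1)

∑≡n⇒≡1 : ∀ {n} {g : Fin n → ℕ} → (∀ k → g k ≤ 1) → ∑ g ≡ n → ∀ k → g k ≡ 1
∑≡n⇒≡1 {n} g≤1 ∑≡ = ∑-mono-tight g≤1 (trans ∑≡ (sym (∑-ones n)))

∑≡1+n⇒≡1 : ∀ {n} {g : Fin n → ℕ} {j} → (∀ k → g k ≤ twoAt j k) → ∑ g ≡ suc n →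
           ∀ k → k ≢ j → g k ≡ 1
∑≡1+n⇒≡1 {j = j} g≤ ∑≡ k k≢j =
  trans (∑-mono-tight g≤ (trans ∑≡ (sym (∑-twoAt j))) k) (twoAt-other k≢j)

by-position : ∀ {n} {P : Fin n → Set} j →
              (∀ k → k <ᶠ j → P k) → P j → (∀ k → j <ᶠ k → P k) → ∀ k → P k
by-position j below at above k with Fin.<-cmp k j
... | tri< k<j _ _  = below k k<j
... | tri≈ _ refl _ = at
... | tri> _ _ j<k  = above k j<k

≤twoAt : ∀ {n} {g : Fin n → ℕ} {j} → g j ≤ 2 → (∀ k → k ≢ j → g k ≤ 1) →
         ∀ k → g k ≤ twoAt j k
≤twoAt {g = g} {j} gj≤2 g≤1 k with k Fin.≟ j
... | yes refl = subst (g j ≤_) (sym (twoAt-self j)) gj≤2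
... | no k≢j   = subst (g k ≤_) (sym (twoAt-other k≢j)) (g≤1 k k≢j)

∑-twoAt-profile : ∀ {n} {g : Fin n → ℕ} {j} → g j ≡ 2 →
                  (∀ k → k <ᶠ j → g k ≡ 1) → (∀ k → j <ᶠ k → g k ≡ 1) → ∑ g ≡ suc n
∑-twoAt-profile {g = g} {j} gj≡2 below above = trans (∑-cong g≡twoAt) (∑-twoAt j)
  where
  g≡twoAt : ∀ k → g k ≡ twoAt j k
  g≡twoAt = by-position j
    (λ k k<j → trans (below k k<j) (sym (twoAt-other (Fin.<⇒≢ k<j))))
    (trans gj≡2 (sym (twoAt-self j)))
    (λ k j<k → trans (above k j<k) (sym (twoAt-other (Fin.<⇒≢ j<k ∘ sym))))

-- Blocks of a set avoiding the leading monomials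

module _ {a b c d r l s z : Bool} (e : (a , b , c , d) ≡ (r , l , s , z)) where
  inter-yr : a ≡ r
  inter-yr = cong proj₁ e
  inter-yl : b ≡ l
  inter-yl = cong (proj₁ ∘ proj₂) e
  inter-t : c ≡ s
  inter-t = cong (proj₁ ∘ proj₂ ∘ proj₂) e
  inter-ze : d ≡ z
  inter-ze = cong (proj₂ ∘ proj₂ ∘ proj₂) e

pattern none    = (false , false , false , false)
pattern only-yr = (true  , false , false , false)
pattern only-yl = (false , true  , false , false)
pattern only-t  = (false , false , true  , false)
pattern only-ze = (false , false , false , true )
pattern yr+ze   = (true  , false , false , true )
pattern yl+ze   = (false , true  , false , true )

data BlockView (q : Bool × Bool × Bool × Bool) : Set where
  ⟨⟩      : q ≡ none → BlockView q
  ⟨yr⟩    : q ≡ only-yr → BlockView q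
  ⟨yl⟩    : q ≡ only-yl → BlockView q
  ⟨t⟩     : q ≡ only-t → BlockView q
  ⟨ze⟩    : q ≡ only-ze → BlockView q
  ⟨yr,ze⟩ : q ≡ yr+ze → BlockView q
  ⟨yl,ze⟩ : q ≡ yl+ze → BlockView q

data SingletonView (q : Bool × Bool × Bool × Bool) : Set where
  ⟨yr⟩ : q ≡ only-yr → SingletonView q
  ⟨yl⟩ : q ≡ only-yl → SingletonView q
  ⟨t⟩  : q ≡ only-t → SingletonView q
  ⟨ze⟩ : q ≡ only-ze → SingletonView q

block-view : ∀ {m} {S : VarSet m} → AvoidsLeading S →
             ∀ k → BlockView (S (yr k) , S (yl k) , S (t k) , S (ze k))
block-view {S = S} avoids k with S (yr k) in r | S (yl k) in l | S (t k) in s | S (ze k) in z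
... | false | false | false | false = ⟨⟩ refl
... | true  | false | false | false = ⟨yr⟩ refl
... | false | true  | false | false = ⟨yl⟩ refl
... | false | false | true  | false = ⟨t⟩ refl
... | false | false | false | true  = ⟨ze⟩ refl
... | true  | false | false | true  = ⟨yr,ze⟩ refl
... | false | true  | false | true  = ⟨yl,ze⟩ refl
... | true  | true  | _     | _     = ⊥-elim (avoids (yr·yl k k) (r ∷ l ∷ []))
... | true  | _     | true  | _     = ⊥-elim (avoids (yr·t k) (r ∷ s ∷ []))
... | _     | true  | true  | _     = ⊥-elim (avoids (yl·t k) (l ∷ s ∷ []))
... | _     | _     | true  | true  = ⊥-elim (avoids (t·ze k) (s ∷ z ∷ []))

count-≤1 : ∀ {q} → BlockView q → count q ≢ 2 → count q ≤ 1
count-≤1 (⟨⟩ refl)      _  = z≤n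
count-≤1 (⟨yr⟩ refl)    _  = ≤-refl
count-≤1 (⟨yl⟩ refl)    _  = ≤-refl
count-≤1 (⟨t⟩ refl)     _  = ≤-refl
count-≤1 (⟨ze⟩ refl)    _  = ≤-refl
count-≤1 (⟨yr,ze⟩ refl) ≢2 = contradiction refl ≢2
count-≤1 (⟨yl,ze⟩ refl) ≢2 = contradiction refl ≢2

double-view : ∀ {q} → BlockView q → count q ≡ 2 → q ≡ yr+ze ⊎ q ≡ yl+ze
double-view (⟨yr,ze⟩ e) _  = inj₁ e
double-view (⟨yl,ze⟩ e) _  = inj₂ e
double-view (⟨⟩ refl)   ()
double-view (⟨yr⟩ refl) ()
double-view (⟨yl⟩ refl) ()
double-view (⟨t⟩ refl)  ()
double-view (⟨ze⟩ refl) ()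

singleton-view : ∀ {q} → BlockView q → count q ≡ 1 → SingletonView q
singleton-view (⟨yr⟩ e)       _  = ⟨yr⟩ e
singleton-view (⟨yl⟩ e)       _  = ⟨yl⟩ e
singleton-view (⟨t⟩ e)        _  = ⟨t⟩ e
singleton-view (⟨ze⟩ e)       _  = ⟨ze⟩ e
singleton-view (⟨⟩ refl)      ()
singleton-view (⟨yr,ze⟩ refl) ()
singleton-view (⟨yl,ze⟩ refl) ()

module _ {m : ℕ} where
  Case-i : VarSet m → Set
  Case-i S = S z1 ≡ true × S z2 ≡ false × Σ (Fin m) λ j →
    inter S j ≡ yr+ze ×
    (∀ k → k <ᶠ j → inter S k ≡ only-t ⊎ inter S k ≡ only-ze) ×
    (∀ k → j <ᶠ k → inter S k ≡ only-t ⊎ inter S k ≡ only-yr)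

  Case-ii : VarSet m → Set
  Case-ii S = S z2 ≡ true × S z1 ≡ false × Σ (Fin m) λ j →
    inter S j ≡ yl+ze ×
    (∀ k → k <ᶠ j → inter S k ≡ only-t ⊎ inter S k ≡ only-yl) ×
    (∀ k → j <ᶠ k → inter S k ≡ only-t ⊎ inter S k ≡ only-ze)

  Case-iii : VarSet m → Set
  Case-iii S = S z1 ≡ true × S z2 ≡ true ×
    (∀ k → inter S k ≡ only-ze ⊎ inter S k ≡ only-t)

module Avoiding {m : ℕ} {S : VarSet m} (avoids : AvoidsLeading S) where
  view : ∀ k → BlockView (inter S k)
  view = block-view avoids

  yl∉ : S z1 ≡ true → ∀ k → S (yl k) ≢ true
  yl∉ z1∈ k yl∈ = avoids (yl·z1 k) (yl∈ ∷ z1∈ ∷ [])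

  yr∉ : S z2 ≡ true → ∀ k → S (yr k) ≢ true
  yr∉ z2∈ k yr∈ = avoids (yr·z2 k) (yr∈ ∷ z2∈ ∷ [])

  doubles-ordered : ∀ j k → j <ᶠ k → blockCount S j ≡ 2 → blockCount S k ≢ 2
  doubles-ordered j k j<k cj ck with double-view (view j) cj | double-view (view k) ck
  ... | inj₁ ej | inj₁ ek = avoids (yr·ze j k j<k) (inter-yr ej ∷ inter-ze ek ∷ [])
  ... | inj₁ ej | inj₂ ek = avoids (yr·yl j k) (inter-yr ej ∷ inter-yl ek ∷ [])
  ... | inj₂ ej | inj₁ ek = avoids (yr·yl k j) (inter-yr ek ∷ inter-yl ej ∷ [])
  ... | inj₂ ej | inj₂ ek = avoids (yl·ze k j j<k) (inter-yl ek ∷ inter-ze ej ∷ [])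

  double-unique : ∀ {j k} → blockCount S j ≡ 2 → blockCount S k ≡ 2 → k ≡ j
  double-unique {j} {k} cj ck with Fin.<-cmp k j
  ... | tri< k<j _ _ = contradiction cj (doubles-ordered k j k<j ck)
  ... | tri≈ _ k≡j _ = k≡j
  ... | tri> _ _ j<k = contradiction ck (doubles-ordered j k j<k cj)

  single-or-double : (∀ k → blockCount S k ≤ 1) ⊎
                     Σ (Fin m) λ j → blockCount S j ≡ 2 × (∀ k → blockCount S k ≤ twoAt j k)
  single-or-double with Fin.any? (λ j → blockCount S j ≟ 2)
  ... | no ∄double   = inj₁ λ k → count-≤1 (view k) (λ ck → ∄double (k , ck))
  ... | yes (j , cj) = inj₂ (j , cj , ≤twoAt (≤-reflexive cj)
                              λ k k≢j → count-≤1 (view k) (k≢j ∘ double-unique cj))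

  ∑≤1+m : ∑ (blockCount S) ≤ suc m
  ∑≤1+m with single-or-double
  ... | inj₁ ≤1              = m≤n⇒m≤1+n (∑≤n ≤1)
  ... | inj₂ (j , _ , bound) = subst (_ ≤_) (∑-twoAt j) (∑-mono-≤ bound)

  case-i : S z1 ≡ true → S z2 ≡ false → ∑ (blockCount S) ≡ suc m → Case-i S
  case-i z1∈ z2∉ ∑≡ with single-or-double
  ... | inj₁ ≤1 = ⊥-elim (1+n≰n (subst (_≤ m) ∑≡ (∑≤n ≤1)))
  ... | inj₂ (j , cj , bound) with double-view (view j) cj
  ...   | inj₂ ej = ⊥-elim (yl∉ z1∈ j (inter-yl ej))
  ...   | inj₁ ej = z1∈ , z2∉ , j , ej , below , above
    where
    singleton : ∀ k → k ≢ j → SingletonView (inter S k)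
    singleton k k≢j = singleton-view (view k) (∑≡1+n⇒≡1 bound ∑≡ k k≢j)
    below : ∀ k → k <ᶠ j → inter S k ≡ only-t ⊎ inter S k ≡ only-ze
    below k k<j with singleton k (Fin.<⇒≢ k<j)
    ... | ⟨yr⟩ e = ⊥-elim (avoids (yr·ze k j k<j) (inter-yr e ∷ inter-ze ej ∷ []))
    ... | ⟨yl⟩ e = ⊥-elim (yl∉ z1∈ k (inter-yl e))
    ... | ⟨t⟩ e  = inj₁ e
    ... | ⟨ze⟩ e = inj₂ e
    above : ∀ k → j <ᶠ k → inter S k ≡ only-t ⊎ inter S k ≡ only-yr
    above k j<k with singleton k (Fin.<⇒≢ j<k ∘ sym)
    ... | ⟨yr⟩ e = inj₂ e
    ... | ⟨yl⟩ e = ⊥-elim (yl∉ z1∈ k (inter-yl e))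
    ... | ⟨t⟩ e  = inj₁ e
    ... | ⟨ze⟩ e = ⊥-elim (avoids (yr·ze j k j<k) (inter-yr ej ∷ inter-ze e ∷ []))

  case-ii : S z2 ≡ true → S z1 ≡ false → ∑ (blockCount S) ≡ suc m → Case-ii S
  case-ii z2∈ z1∉ ∑≡ with single-or-double
  ... | inj₁ ≤1 = ⊥-elim (1+n≰n (subst (_≤ m) ∑≡ (∑≤n ≤1)))
  ... | inj₂ (j , cj , bound) with double-view (view j) cj
  ...   | inj₁ ej = ⊥-elim (yr∉ z2∈ j (inter-yr ej))
  ...   | inj₂ ej = z2∈ , z1∉ , j , ej , below , above
    where
    singleton : ∀ k → k ≢ j → SingletonView (inter S k)
    singleton k k≢j = singleton-view (view k) (∑≡1+n⇒≡1 bound ∑≡ k k≢j)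
    below : ∀ k → k <ᶠ j → inter S k ≡ only-t ⊎ inter S k ≡ only-yl
    below k k<j with singleton k (Fin.<⇒≢ k<j)
    ... | ⟨yr⟩ e = ⊥-elim (yr∉ z2∈ k (inter-yr e))
    ... | ⟨yl⟩ e = inj₂ e
    ... | ⟨t⟩ e  = inj₁ e
    ... | ⟨ze⟩ e = ⊥-elim (avoids (yl·ze j k k<j) (inter-yl ej ∷ inter-ze e ∷ []))
    above : ∀ k → j <ᶠ k → inter S k ≡ only-t ⊎ inter S k ≡ only-ze
    above k j<k with singleton k (Fin.<⇒≢ j<k ∘ sym)
    ... | ⟨yr⟩ e = ⊥-elim (yr∉ z2∈ k (inter-yr e))
    ... | ⟨yl⟩ e = ⊥-elim (avoids (yl·ze k j j<k) (inter-yl e ∷ inter-ze ej ∷ []))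
    ... | ⟨t⟩ e  = inj₁ e
    ... | ⟨ze⟩ e = inj₂ e

  case-iii : S z1 ≡ true → S z2 ≡ true → ∑ (blockCount S) ≡ m → Case-iii S
  case-iii z1∈ z2∈ ∑≡ = z1∈ , z2∈ , ze-or-t
    where
    ≤1 : ∀ k → blockCount S k ≤ 1
    ≤1 k = count-≤1 (view k) λ ck →
      [ yr∉ z2∈ k ∘ inter-yr , yl∉ z1∈ k ∘ inter-yl ]′ (double-view (view k) ck)
    ze-or-t : ∀ k → inter S k ≡ only-ze ⊎ inter S k ≡ only-t
    ze-or-t k with singleton-view (view k) (∑≡n⇒≡1 ≤1 ∑≡ k)
    ... | ⟨yr⟩ e = ⊥-elim (yr∉ z2∈ k (inter-yr e))
    ... | ⟨yl⟩ e = ⊥-elim (yl∉ z1∈ k (inter-yl e))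
    ... | ⟨t⟩ e  = inj₂ e
    ... | ⟨ze⟩ e = inj₁ e

  card⇒cases : card S ≡ m + 2 → Case-i S ⊎ Case-ii S ⊎ Case-iii S
  card⇒cases card≡ =
    by-z (S z1) (S z2) refl refl (trans (sym (card-blocks S)) (trans card≡ (+-comm m 2)))
    where
    by-z : ∀ a b → S z1 ≡ a → S z2 ≡ b → bit a + (bit b + ∑ (blockCount S)) ≡ 2 + m →
           Case-i S ⊎ Case-ii S ⊎ Case-iii S
    by-z true  true  z1∈ z2∈ ∑≡ = inj₂ (inj₂ (case-iii z1∈ z2∈ (+-cancelˡ-≡ 2 _ _ ∑≡)))
    by-z true  false z1∈ z2∉ ∑≡ = inj₁ (case-i z1∈ z2∉ (suc-injective ∑≡))
    by-z false true  z1∉ z2∈ ∑≡ = inj₂ (inj₁ (case-ii z2∈ z1∉ (suc-injective ∑≡)))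
    by-z false false _   _   ∑≡ = ⊥-elim (1+n≰n (subst (_≤ suc m) ∑≡ ∑≤1+m))

facet⇒cases : ∀ {m} {S : VarSet m} → IsFacet m S → Case-i S ⊎ Case-ii S ⊎ Case-iii S
facet⇒cases (card≡ , no-leading) = Avoiding.card⇒cases (no-leading⇒avoids no-leading) card≡

t-set⇒only-t : ∀ {a b c d r l z} → c ≡ true →
               (a , b , c , d) ≡ only-t ⊎ (a , b , c , d) ≡ (r , l , false , z) →
               (a , b , c , d) ≡ only-t
t-set⇒only-t _   (inj₁ e) = e
t-set⇒only-t c∈ (inj₂ e) = ⊥-elim (not-¬ c∈ (inter-t e))

module _ {m : ℕ} {S : VarSet m} where
  case-i⇒facet : Case-i S → IsFacet m S
  case-i⇒facet (z1∈ , z2∉ , j , ej , below , above) = card≡ , avoids⇒no-leading avoids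
    where
    card≡ : card S ≡ m + 2
    card≡ = card≡m+2 S z1∈ z2∉ (cong suc (∑-twoAt-profile {g = blockCount S} (cong count ej)
      (λ k → [ cong count , cong count ]′ ∘ below k)
      (λ k → [ cong count , cong count ]′ ∘ above k)))
    yl∉ : ∀ k → S (yl k) ≡ false
    yl∉ = by-position j
      (λ k → [ inter-yl , inter-yl ]′ ∘ below k)
      (inter-yl ej)
      (λ k → [ inter-yl , inter-yl ]′ ∘ above k)
    t∈⇒only-t : ∀ k → S (t k) ≡ true → inter S k ≡ only-t
    t∈⇒only-t = by-position j
      (λ k k<j t∈ → t-set⇒only-t t∈ (below k k<j))
      (λ t∈ → t-set⇒only-t t∈ (inj₂ ej))
      (λ k j<k t∈ → t-set⇒only-t t∈ (above k j<k))
    yr∈⇒j≤ : ∀ k → S (yr k) ≡ true → toℕ j ≤ toℕ k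
    yr∈⇒j≤ = by-position j
      (λ k k<j yr∈ → ⊥-elim (not-¬ yr∈ ([ inter-yr , inter-yr ]′ (below k k<j))))
      (λ _ → ≤-refl)
      (λ _ j<k _ → <⇒≤ j<k)
    ze∈⇒≤j : ∀ k → S (ze k) ≡ true → toℕ k ≤ toℕ j
    ze∈⇒≤j = by-position j
      (λ _ k<j _ → <⇒≤ k<j)
      (λ _ → ≤-refl)
      (λ k j<k ze∈ → ⊥-elim (not-¬ ze∈ ([ inter-ze , inter-ze ]′ (above k j<k))))
    avoids : AvoidsLeading S
    avoids (yr·yl i k)     (_ ∷ yl∈ ∷ [])   = not-¬ yl∈ (yl∉ k)
    avoids (yr·t i)        (yr∈ ∷ t∈ ∷ [])  = not-¬ yr∈ (inter-yr (t∈⇒only-t i t∈))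
    avoids (yl·t i)        (yl∈ ∷ _ ∷ [])   = not-¬ yl∈ (yl∉ i)
    avoids (yr·z2 i)       (_ ∷ z2∈ ∷ [])   = not-¬ z2∈ z2∉
    avoids (yl·z1 i)       (yl∈ ∷ _ ∷ [])   = not-¬ yl∈ (yl∉ i)
    avoids (t·ze i)        (t∈ ∷ ze∈ ∷ [])  = not-¬ ze∈ (inter-ze (t∈⇒only-t i t∈))
    avoids (yr·ze i k i<k) (yr∈ ∷ ze∈ ∷ []) = <⇒≱ i<k (≤-trans (ze∈⇒≤j k ze∈) (yr∈⇒j≤ i yr∈))
    avoids (yl·ze i k _)   (yl∈ ∷ _ ∷ [])   = not-¬ yl∈ (yl∉ i)

  case-ii⇒facet : Case-ii S → IsFacet m S
  case-ii⇒facet (z2∈ , z1∉ , j , ej , below , above) = card≡ , avoids⇒no-leading avoids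
    where
    card≡ : card S ≡ m + 2
    card≡ = card≡m+2 S z1∉ z2∈ (cong suc (∑-twoAt-profile {g = blockCount S} (cong count ej)
      (λ k → [ cong count , cong count ]′ ∘ below k)
      (λ k → [ cong count , cong count ]′ ∘ above k)))
    yr∉ : ∀ k → S (yr k) ≡ false
    yr∉ = by-position j
      (λ k → [ inter-yr , inter-yr ]′ ∘ below k)
      (inter-yr ej)
      (λ k → [ inter-yr , inter-yr ]′ ∘ above k)
    t∈⇒only-t : ∀ k → S (t k) ≡ true → inter S k ≡ only-t
    t∈⇒only-t = by-position j
      (λ k k<j t∈ → t-set⇒only-t t∈ (below k k<j))
      (λ t∈ → t-set⇒only-t t∈ (inj₂ ej))
      (λ k j<k t∈ → t-set⇒only-t t∈ (above k j<k))
    yl∈⇒≤j : ∀ k → S (yl k) ≡ true → toℕ k ≤ toℕ j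
    yl∈⇒≤j = by-position j
      (λ _ k<j _ → <⇒≤ k<j)
      (λ _ → ≤-refl)
      (λ k j<k yl∈ → ⊥-elim (not-¬ yl∈ ([ inter-yl , inter-yl ]′ (above k j<k))))
    ze∈⇒j≤ : ∀ k → S (ze k) ≡ true → toℕ j ≤ toℕ k
    ze∈⇒j≤ = by-position j
      (λ k k<j ze∈ → ⊥-elim (not-¬ ze∈ ([ inter-ze , inter-ze ]′ (below k k<j))))
      (λ _ → ≤-refl)
      (λ _ j<k _ → <⇒≤ j<k)
    avoids : AvoidsLeading S
    avoids (yr·yl i k)     (yr∈ ∷ _ ∷ [])   = not-¬ yr∈ (yr∉ i)
    avoids (yr·t i)        (yr∈ ∷ _ ∷ [])   = not-¬ yr∈ (yr∉ i)
    avoids (yl·t i)        (yl∈ ∷ t∈ ∷ [])  = not-¬ yl∈ (inter-yl (t∈⇒only-t i t∈))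
    avoids (yr·z2 i)       (yr∈ ∷ _ ∷ [])   = not-¬ yr∈ (yr∉ i)
    avoids (yl·z1 i)       (_ ∷ z1∈ ∷ [])   = not-¬ z1∈ z1∉
    avoids (t·ze i)        (t∈ ∷ ze∈ ∷ [])  = not-¬ ze∈ (inter-ze (t∈⇒only-t i t∈))
    avoids (yr·ze i k _)   (yr∈ ∷ _ ∷ [])   = not-¬ yr∈ (yr∉ i)
    avoids (yl·ze i k k<i) (yl∈ ∷ ze∈ ∷ []) = <⇒≱ k<i (≤-trans (yl∈⇒≤j i yl∈) (ze∈⇒j≤ k ze∈))

  case-iii⇒facet : Case-iii S → IsFacet m S
  case-iii⇒facet (z1∈ , z2∈ , ze-or-t) = card≡ , avoids⇒no-leading avoids
    where
    card≡ : card S ≡ m + 2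
    card≡ = card≡m+2 S z1∈ z2∈
      (cong (2 +_) (trans (∑-cong ([ cong count , cong count ]′ ∘ ze-or-t)) (∑-ones m)))
    yr∉ : ∀ k → S (yr k) ≡ false
    yr∉ k = [ inter-yr , inter-yr ]′ (ze-or-t k)
    yl∉ : ∀ k → S (yl k) ≡ false
    yl∉ k = [ inter-yl , inter-yl ]′ (ze-or-t k)
    t∈⇒ze∉ : ∀ k → S (t k) ≡ true → S (ze k) ≡ false
    t∈⇒ze∉ k t∈ = inter-ze (t-set⇒only-t t∈ (swap (ze-or-t k)))
    avoids : AvoidsLeading S
    avoids (yr·yl i k)   (yr∈ ∷ _ ∷ [])  = not-¬ yr∈ (yr∉ i)
    avoids (yr·t i)      (yr∈ ∷ _ ∷ [])  = not-¬ yr∈ (yr∉ i)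
    avoids (yl·t i)      (yl∈ ∷ _ ∷ [])  = not-¬ yl∈ (yl∉ i)
    avoids (yr·z2 i)     (yr∈ ∷ _ ∷ [])  = not-¬ yr∈ (yr∉ i)
    avoids (yl·z1 i)     (yl∈ ∷ _ ∷ [])  = not-¬ yl∈ (yl∉ i)
    avoids (t·ze i)      (t∈ ∷ ze∈ ∷ []) = not-¬ ze∈ (t∈⇒ze∉ i t∈)
    avoids (yr·ze i k _) (yr∈ ∷ _ ∷ [])  = not-¬ yr∈ (yr∉ i)
    avoids (yl·ze i k _) (yl∈ ∷ _ ∷ [])  = not-¬ yl∈ (yl∉ i)

theorem4p12 : (m : ℕ) → 1 ≤ m → (S : VarSet m) →
    IsFacet m S ⇔
      ( -- (i)
        (S z1 ≡ true × S z2 ≡ false × Σ (Fin m) λ j →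
          inter S j ≡ (true , false , false , true) ×
          (∀ k → k <ᶠ j → inter S k ≡ (false , false , true , false) ⊎ inter S k ≡ (false , false , false , true)) ×
          (∀ k → j <ᶠ k → inter S k ≡ (false , false , true , false) ⊎ inter S k ≡ (true , false , false , false)))
      ⊎ -- (ii)
        (S z2 ≡ true × S z1 ≡ false × Σ (Fin m) λ j →
          inter S j ≡ (false , true , false , true) ×
          (∀ k → k <ᶠ j → inter S k ≡ (false , false , true , false) ⊎ inter S k ≡ (false , true , false , false)) ×
          (∀ k → j <ᶠ k → inter S k ≡ (false , false , true , false) ⊎ inter S k ≡ (false , false , false , true)))
      ⊎ -- (iii)
        (S z1 ≡ true × S z2 ≡ true ×
          (∀ k → inter S k ≡ (false , false , false , true) ⊎ inter S k ≡ (false , false , true , false))))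
theorem4p12 m _ S = mk⇔ facet⇒cases [ case-i⇒facet , [ case-ii⇒facet , case-iii⇒facet ]′ ]′
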